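{- Let $G=(V,E)$ be a connected finite simple undirected graph with at least 3 vertices and threshold function $t:V\to\mathbb{N}_0$. Let $V^{(2)}=\{v\in V: d(v)\ge 2\}$, let $A=\{u\in V: u\in V^{(2)} \text{ or } t(u)\neq 1\}$, and for $v\in V$ let $d^{(2)}(v)=|\{u\in\Gamma(v): u\in A\}|$. Then Algorithm TSS on $(G,t)$ outputs a target set $S$ with $$|S|\le \sum_{v\in A}\min\left(1,\frac{t(v)}{d^{(2)}(v)+1}\right).$$
   Context: $\Gamma(v)$ is the neighborhood of $v$ in $G$ and $d(v)=|\Gamma(v)|$. $\mathbb{N}_0=\{0,1,2,\ldots\}$. Activation process: for $S\subseteq V$, $\mathrm{Active}[S,0]=S$ and for $\ell\ge1$, $\mathrm{Active}[S,\ell]=\mathrm{Active}[S,\ell-1]\cup\{u\in V: |\Gamma(u)\cap \mathrm{Active}[S,\ell-1]|\ge t(u)\}$. $S$ is a target set for $G$ if $\mathrm{Active}[S,\lambda]=V$ for some $\lambda\ge0$. Algorithm TSS on input $(G,t)$: set $S=\emptyset$, $U=V$, and for each $v\in V$ set $\delta(v)=d(v)$, $k(v)=t(v)$, $N(v)=\Gamma(v)$. While $U\neq\emptyset$: (Case 1) if some $v\in U$ has $k(v)=0$, select such a $v$ and for each $u\in N(v)$ set $k(u)=\max(k(u)-1,0)$; (Case 2) otherwise, if some $v\in U$ has $\delta(v)<k(v)$, select such a $v$, set $S=S\cup\{v\}$, and for each $u\in N(v)$ set $k(u)=k(u)-1$; (Case 3) otherwise select $v\in\arg\max_{u\in U}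 \frac{k(u)}{\delta(u)(\delta(u)+1)}$. In every case, then, for each $u\in N(v)$ set $\delta(u)=\delta(u)-1$ and $N(u)=N(u)\setminus\{v\}$, and set $U=U\setminus\{v\}$. When $U=\emptyset$, output $S$. (When several vertices qualify for selection, the algorithm picks one of them; the choice rule is not specified.) -}

module Defs where

open import Data.Nat using (ℕ; zero; suc; _∸_; _≤_; _<_; _≤?_; _≤ᵇ_; _≡ᵇ_)
open import Data.Bool using (Bool; true; false; _∨_; not; if_then_else_)
open import Data.Fin using (Fin)
open import Data.Fin.Subset using (Subset; _∈_; _∉_; ∣_∣; _∩_; _∪_; ⁅_⁆; ∁; ⊤; ⊥)
open import Data.Fin.Subset.Properties using (_∈?_)
open import Data.Vec using (tabulate; allFin; foldr)
open import Data.Integer using (+_)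
open import Data.Rational using (ℚ; _/_; 0ℚ; 1ℚ; _⊓_) renaming (_+_ to _+ℚ_)
open import Data.Product using (∃)
open import Relation.Nullary using (does; ¬_)
open import Relation.Binary.PropositionalEquality using (_≡_; _≢_)
open import Relation.Binary.Construct.Closure.ReflexiveTransitive using (Star)

record Graph (n : ℕ) : Set where
  field
    Γ     : Fin n → Subset n
    sym   : ∀ {u v} → u ∈ Γ v → v ∈ Γ u
    irrfl : ∀ {v} → v ∉ Γ v
open Graph public

deg : ∀ {n} → Graph n → Fin n → ℕ
deg G v = ∣ Γ G v ∣

Adj : ∀ {n} → Graph n → Fin n → Fin n → Set
Adj G u v = v ∈ Γ G u

Connected : ∀ {n} → Graph n → Set
Connected {n} G = ∀ (u v : Fin n) → Star (Adj G) u v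

Active : ∀ {n} → Graph n → (Fin n → ℕ) → Subset n → ℕ → Subset n
Active G t S zero = S
Active G t S (suc ℓ) =
  Active G t S ℓ ∪ tabulate (λ u → does (t u ≤? ∣ Γ G u ∩ Active G t S ℓ ∣))

IsTargetSet : ∀ {n} → Graph n → (Fin n → ℕ) → Subset n → Set
IsTargetSet G t S = ∃ λ λ' → Active G t S λ' ≡ ⊤

-- Algorithm TSS, as a nondeterministic transition system

record TSSState (n : ℕ) : Set where
  constructor mkState
  field
    S  : Subset n
    U  : Subset n
    δ  : Fin n → ℕ
    k  : Fin n → ℕ
    N  : Fin n → Subset n
open TSSState public

initState : ∀ {n} → Graph n → (Fin n → ℕ) → TSSState n
initState G t = mkState ⊥ ⊤ (deg G) t (Γ G)

updOn : ∀ {n} → Subset n → (ℕ → ℕ) → (Fin n → ℕ) → Fin n → ℕ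
updOn X f g u = if does (u ∈? X) then f (g u) else g u

removeV : ∀ {n} → TSSState n → Fin n → Subset n → (Fin n → ℕ) → TSSState n
removeV st v S' k' = mkState
  S'
  (U st ∩ ∁ ⁅ v ⁆)
  (updOn (N st v) (λ x → x ∸ 1) (δ st))
  k'
  (λ u → if does (u ∈? N st v) then N st u ∩ ∁ ⁅ v ⁆ else N st u)

-- k(u)/(δ(u)(δ(u)+1)) as a rational number (δ(u) = 0 never occurs in Case 3;
-- the value 0 is then a harmless convention)
ratio : ℕ → ℕ → ℚ
ratio k zero = 0ℚ
ratio k (suc d) = (+ k) / (suc d Data.Nat.* suc (suc d))

data TSSStep {n : ℕ} : TSSState n → TSSState n → Set where
  case1 : ∀ st v → v ∈ U st → k st v ≡ 0 →
          TSSStep st (removeV st v (S st) (updOn (N st v) (λ x → x ∸ 1) (k st)))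
  case2 : ∀ st v →
          (∀ u → u ∈ U st → k st u ≢ 0) →
          v ∈ U st → δ st v < k st v →
          TSSStep st (removeV st v (S st ∪ ⁅ v ⁆) (updOn (N st v) (λ x → x ∸ 1) (k st)))
  case3 : ∀ st v →
          (∀ u → u ∈ U st → k st u ≢ 0) →
          (∀ u → u ∈ U st → ¬ (δ st u < k st u)) →
          v ∈ U st →
          (∀ u → u ∈ U st →
             Data.Rational._≤_ (ratio (k st u) (δ st u)) (ratio (k st v) (δ st v))) →
          TSSStep st (removeV st v (S st) (k st))

TSSOutput : ∀ {n} → Graph n → (Fin n → ℕ) → Subset n → Set
TSSOutput G t S₀ = ∃ λ st → Star TSSStep (initState G t) st × U st ≡ ⊥ × S st ≡ S₀
  where open import Data.Product using (_×_)

setA : ∀ {n} → Graph n → (Fin n → ℕ) → Subset n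
setA G t = tabulate (λ u → (2 ≤ᵇ deg G u) ∨ not (t u ≡ᵇ 1))

deg2 : ∀ {n} → Graph n → (Fin n → ℕ) → Fin n → ℕ
deg2 G t v = ∣ Γ G v ∩ setA G t ∣

bound : ∀ {n} → Graph n → (Fin n → ℕ) → ℚ
bound {n} G t = foldr _ _+ℚ_ 0ℚ (tabulate term)
  where
  term : Fin n → ℚ
  term v = if does (v ∈? setA G t)
           then 1ℚ ⊓ ((+ t v) / suc (deg2 G t v))
           else 0ℚ

module Submission where

-- During a run, an undecided vertex u ∈ U weighs
-- τ(u) = min(1, k(u)/(|N(u) ∩ A|+1)) if u ∈ A, and τ(u) = [δ(u) < k(u)] otherwise (such a
-- u is a leaf with t(u) = 1).  The potential Φ = |S| + Σ_{u ∈ U} τ(u) equals the bound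
-- initially and never increases: in Cases 1 and 2 the neighbours of v only lose weight,
-- and in Case 2 the weight 1 of v pays for putting v into S; in Case 3 the weight of v pays
-- for what its neighbours gain, either because δ(v) = k(v) = 1, or because then all of U
-- lies in A and the maximality of k(v)/(δ(v)(δ(v)+1)) bounds each gain.  Connectivity and
-- n ≥ 3 are used only to exclude isolated vertices and edges between two vertices outside A.
-- At the end U = ∅, so |S| ≤ Φ ≤ bound.
--
-- Target set.  Along the run, t(u) ≤ k(u) + |removed neighbours of u that are active| for
-- every u ∈ U; by induction over the rest of the run every vertex of U becomes active.

open import Data.Nat using (ℕ)
open import Data.Fin using (Fin)
open import Defs using (Graph)

module Subsets where

  open import Data.Nat using (zero; suc; _+_; _≤_; s≤s; z≤n)
  import Data.Nat.Properties as ℕₚ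
  open import Data.Bool using (Bool; true; false)
  open import Data.Fin using (zero; suc)
  import Data.Fin.Properties as Finₚ
  open import Data.Fin.Subset using (Subset; _∈_; _∉_; ∣_∣; _∩_; _∪_; ∁; ⁅_⁆; ⊤; ⊥)
  open import Data.Fin.Subset.Properties
  open import Data.Vec using ([]; _∷_; tabulate; here; there)
  import Data.Vec.Properties as Vecₚ
  open import Data.Product using (_,_; proj₁; proj₂)
  open import Data.Sum using (_⊎_)
  open import Data.Empty using (⊥-elim)
  open import Relation.Nullary using (yes; no)
  open import Relation.Binary.PropositionalEquality
  open import Function using (_∘_)

  private variable
    n : ℕ
    p q : Subset n
    x y : Fin n

  ∩⁺ : x ∈ p → x ∈ q → x ∈ p ∩ q
  ∩⁺ x∈p x∈q = x∈p∩q⁺ (x∈p , x∈q)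

  ∩ˡ : x ∈ p ∩ q → x ∈ p
  ∩ˡ {p = p} {q} x∈p∩q = proj₁ (x∈p∩q⁻ p q x∈p∩q)

  ∩ʳ : x ∈ p ∩ q → x ∈ q
  ∩ʳ {p = p} {q} x∈p∩q = proj₂ (x∈p∩q⁻ p q x∈p∩q)

  ∪⁻ : x ∈ p ∪ q → x ∈ p ⊎ x ∈ q
  ∪⁻ {p = p} {q} = x∈p∪q⁻ p q

  remove⁺ : x ∈ p → x ≢ y → x ∈ p ∩ ∁ ⁅ y ⁆
  remove⁺ x∈p x≢y = ∩⁺ x∈p (x∉p⇒x∈∁p (x≢y⇒x∉⁅y⁆ x≢y))

  remove⁻ : x ∈ p ∩ ∁ ⁅ y ⁆ → x ≢ y
  remove⁻ x∈p-y refl = x∈∁p⇒x∉p (∩ʳ x∈p-y) (x∈⁅x⁆ _)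

  ∩∁⊥ : ∀ (p : Subset n) → p ∩ ∁ ⊥ ≡ p
  ∩∁⊥ [] = refl
  ∩∁⊥ (true ∷ p) = cong (true ∷_) (∩∁⊥ p)
  ∩∁⊥ (false ∷ p) = cong (false ∷_) (∩∁⊥ p)

  ∣remove∣ : ∀ (p : Subset n) → x ∈ p → ∣ p ∣ ≡ suc ∣ p ∩ ∁ ⁅ x ⁆ ∣
  ∣remove∣ (true ∷ p) here = cong (λ r → suc ∣ r ∣) (sym (∩∁⊥ p))
  ∣remove∣ (true ∷ p) (there x∈p) = cong suc (∣remove∣ p x∈p)
  ∣remove∣ (false ∷ p) (there x∈p) = ∣remove∣ p x∈p

  remove-∉ : ∀ (p : Subset n) → x ∉ p → p ∩ ∁ ⁅ x ⁆ ≡ p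
  remove-∉ {x = zero} (false ∷ p) x∉p = cong (false ∷_) (∩∁⊥ p)
  remove-∉ {x = zero} (true ∷ p) x∉p = ⊥-elim (x∉p here)
  remove-∉ {x = suc x} (true ∷ p) x∉p = cong (true ∷_) (remove-∉ p (x∉p ∘ there))
  remove-∉ {x = suc x} (false ∷ p) x∉p = cong (false ∷_) (remove-∉ p (x∉p ∘ there))

  remove-∩ : ∀ (p q : Subset n) x → (p ∩ ∁ ⁅ x ⁆) ∩ q ≡ (p ∩ q) ∩ ∁ ⁅ x ⁆
  remove-∩ p q x = begin
    (p ∩ ∁ ⁅ x ⁆) ∩ q  ≡⟨ ∩-assoc p (∁ ⁅ x ⁆) q ⟩
    p ∩ (∁ ⁅ x ⁆ ∩ q)  ≡⟨ cong (p ∩_) (∩-comm (∁ ⁅ x ⁆) q) ⟩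
    p ∩ (q ∩ ∁ ⁅ x ⁆)  ≡⟨ sym (∩-assoc p q (∁ ⁅ x ⁆)) ⟩
    (p ∩ q) ∩ ∁ ⁅ x ⁆  ∎
    where open ≡-Reasoning

  ∣remove∩∣ : ∀ (p q : Subset n) → x ∈ p → x ∈ q → ∣ p ∩ q ∣ ≡ suc ∣ (p ∩ ∁ ⁅ x ⁆) ∩ q ∣
  ∣remove∩∣ {x = x} p q x∈p x∈q =
    trans (∣remove∣ (p ∩ q) (∩⁺ x∈p x∈q)) (cong (λ r → suc ∣ r ∣) (sym (remove-∩ p q x)))

  ∣remove∩∣-∉ : ∀ (p q : Subset n) → x ∉ q → ∣ (p ∩ ∁ ⁅ x ⁆) ∩ q ∣ ≡ ∣ p ∩ q ∣
  ∣remove∩∣-∉ {x = x} p q x∉q =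
    cong ∣_∣ (trans (remove-∩ p q x) (remove-∉ (p ∩ q) (x∉q ∘ ∩ʳ)))

  ∈⇒∣∣≥1 : x ∈ p → 1 ≤ ∣ p ∣
  ∈⇒∣∣≥1 {p = p} x∈p = subst (1 ≤_) (sym (∣remove∣ p x∈p)) (s≤s z≤n)

  ∣∣≤1⇒≡ : ∣ p ∣ ≤ 1 → x ∈ p → y ∈ p → x ≡ y
  ∣∣≤1⇒≡ {p = p} {x} {y} ∣p∣≤1 x∈p y∈p with x Finₚ.≟ y
  ... | yes x≡y = x≡y
  ... | no x≢y = ⊥-elim (ℕₚ.<⇒≱ (s≤s (∈⇒∣∣≥1 (remove⁺ y∈p (x≢y ∘ sym))))
                                (ℕₚ.≤-trans (ℕₚ.≤-reflexive (sym (∣remove∣ p x∈p))) ∣p∣≤1))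

  all⇒∣∣≥n : ∀ {n} {p : Subset n} → (∀ x → x ∈ p) → n ≤ ∣ p ∣
  all⇒∣∣≥n {n} {p} all = ℕₚ.≤-trans (ℕₚ.≤-reflexive (sym (∣⊤∣≡n n))) (p⊆q⇒∣p∣≤∣q∣ {p = ⊤} (λ {x} _ → all x))

  tabulate⁺ : ∀ {f : Fin n → Bool} → f x ≡ true → x ∈ tabulate f
  tabulate⁺ {x = x} {f} fx≡true = Vecₚ.lookup⇒[]= x (tabulate f) (trans (Vecₚ.lookup∘tabulate f x) fx≡true)

  ∣∪∣≤ : ∀ (p q : Subset n) → ∣ p ∪ q ∣ ≤ ∣ p ∣ + ∣ q ∣
  ∣∪∣≤ [] [] = z≤n
  ∣∪∣≤ (true ∷ p) (true ∷ q) = s≤s (ℕₚ.≤-trans (∣∪∣≤ p q) (ℕₚ.+-monoʳ-≤ ∣ p ∣ (ℕₚ.n≤1+n ∣ q ∣)))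
  ∣∪∣≤ (true ∷ p) (false ∷ q) = s≤s (∣∪∣≤ p q)
  ∣∪∣≤ (false ∷ p) (true ∷ q) = ℕₚ.≤-trans (s≤s (∣∪∣≤ p q)) (ℕₚ.≤-reflexive (sym (ℕₚ.+-suc _ _)))
  ∣∪∣≤ (false ∷ p) (false ∷ q) = ∣∪∣≤ p q

  ∣∪∣-disjoint : ∀ (p q : Subset n) → (∀ {x} → x ∈ p → x ∉ q) → ∣ p ∪ q ∣ ≡ ∣ p ∣ + ∣ q ∣
  ∣∪∣-disjoint [] [] _ = refl
  ∣∪∣-disjoint (true ∷ p) (true ∷ q) disj = ⊥-elim (disj here here)
  ∣∪∣-disjoint (true ∷ p) (false ∷ q) disj = cong suc (∣∪∣-disjoint p q (λ a b → disj (there a) (there b)))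
  ∣∪∣-disjoint (false ∷ p) (true ∷ q) disj =
    trans (cong suc (∣∪∣-disjoint p q (λ a b → disj (there a) (there b)))) (sym (ℕₚ.+-suc ∣ p ∣ ∣ q ∣))
  ∣∪∣-disjoint (false ∷ p) (false ∷ q) disj = ∣∪∣-disjoint p q (λ a b → disj (there a) (there b))

module Fractions where

  open import Data.Nat as ℕ using (zero; suc; _∸_; z≤n; s≤s)
  import Data.Nat.Properties as ℕₚ
  open import Data.Nat.Tactic.RingSolver using (solve-∀)
  open import Data.Integer as ℤ using (ℤ; +_; +≤+)
  import Data.Integer.Properties as ℤₚ
  open import Data.Integer.GCD using (gcd)
  import Data.Rational
  open import Data.Rational using (ℚ; _/_; 0ℚ; 1ℚ; _⊓_; _≤_; _+_; toℚᵘ)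
  import Data.Rational.Properties as ℚₚ
  open import Data.Rational.Unnormalised as ℚᵘ using (mkℚᵘ; *≡*; *≤*)
  import Data.Rational.Unnormalised.Properties as ℚᵘₚ
  open import Data.Sum using (_⊎_; inj₁; inj₂)
  open import Data.Empty using (⊥-elim)
  open import Relation.Nullary using (yes; no)
  open import Relation.Binary.PropositionalEquality
  open import Defs using (ratio)

  -- k/(d+1) as a rational number.  It is kept abstract so that the gcd
  -- normalisation hidden in _/_ is never unfolded by the type checker.
  abstract
    frac : ℕ → ℕ → ℚ
    frac k d = + k / suc d

    frac-def : ∀ k d → frac k d ≡ + k / suc d
    frac-def k d = refl

  frac≃ : ∀ k d → toℚᵘ (frac k d) ℚᵘ.≃ mkℚᵘ (+ k) d
  frac≃ k d rewrite frac-def k d = *≡* (begin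
      ℚᵘ.↥ (toℚᵘ q) ℤ.* + suc d  ≡⟨ cong (ℤ._* + suc d) (ℚₚ.↥ᵘ-toℚᵘ q) ⟩
      ↥q ℤ.* + suc d             ≡⟨ cong (↥q ℤ.*_) (sym (ℚₚ.↧-/ (+ k) (suc d))) ⟩
      ↥q ℤ.* (↧q ℤ.* g)          ≡⟨ cong (↥q ℤ.*_) (ℤₚ.*-comm ↧q g) ⟩
      ↥q ℤ.* (g ℤ.* ↧q)          ≡⟨ sym (ℤₚ.*-assoc ↥q g ↧q) ⟩
      (↥q ℤ.* g) ℤ.* ↧q          ≡⟨ cong (ℤ._* ↧q) (ℚₚ.↥-/ (+ k) (suc d)) ⟩
      + k ℤ.* ↧q                 ≡⟨ cong (+ k ℤ.*_) (sym (ℚₚ.↧ᵘ-toℚᵘ q)) ⟩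
      + k ℤ.* ℚᵘ.↧ (toℚᵘ q)      ∎)
    where
    open ≡-Reasoning
    q : ℚ
    q = + k / suc d
    g ↥q ↧q : ℤ
    g = gcd (+ k) (+ suc d)
    ↥q = Data.Rational.↥ q
    ↧q = Data.Rational.↧ q

  private
    +-* : ∀ a b → + a ℤ.* + b ≡ + (a ℕ.* b)
    +-* a b = sym (ℤₚ.pos-* a b)

  frac-≤ : ∀ a b c e → a ℕ.* suc e ℕ.≤ c ℕ.* suc b → frac a b ≤ frac c e
  frac-≤ a b c e h = ℚₚ.toℚᵘ-cancel-≤
    (ℚᵘₚ.≤-respˡ-≃ (ℚᵘₚ.≃-sym (frac≃ a b)) (ℚᵘₚ.≤-respʳ-≃ (ℚᵘₚ.≃-sym (frac≃ c e))
      (*≤* (subst₂ ℤ._≤_ (sym (+-* a (suc e))) (sym (+-* c (suc b))) (+≤+ h)))))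

  frac-≤⁻ : ∀ a b c e → frac a b ≤ frac c e → a ℕ.* suc e ℕ.≤ c ℕ.* suc b
  frac-≤⁻ a b c e h
    with ℚᵘₚ.≤-respˡ-≃ (frac≃ a b) (ℚᵘₚ.≤-respʳ-≃ (frac≃ c e) (ℚₚ.toℚᵘ-mono-≤ h))
  ... | *≤* h′ = ℤₚ.drop‿+≤+ (subst₂ ℤ._≤_ (+-* a (suc e)) (+-* c (suc b)) h′)

  frac-cong : ∀ a b c e → a ℕ.* suc e ≡ c ℕ.* suc b → frac a b ≡ frac c e
  frac-cong a b c e eq =
    ℚₚ.≤-antisym (frac-≤ a b c e (ℕₚ.≤-reflexive eq)) (frac-≤ c e a b (ℕₚ.≤-reflexive (sym eq)))

  frac-+ : ∀ a b c e → frac a b + frac c e ≡ frac (a ℕ.* suc e ℕ.+ c ℕ.* suc b) (e ℕ.+ b ℕ.* suc e)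
  frac-+ a b c e = ℚₚ.toℚᵘ-injective (ℚᵘₚ.≃-trans (ℚₚ.toℚᵘ-homo-+ (frac a b) (frac c e))
    (ℚᵘₚ.≃-trans (ℚᵘₚ.+-cong (frac≃ a b) (frac≃ c e))
      (ℚᵘₚ.≃-trans (*≡* (cong (ℤ._* + suc (e ℕ.+ b ℕ.* suc e)) numerator))
        (ℚᵘₚ.≃-sym (frac≃ _ _)))))
    where
    numerator : + a ℤ.* + suc e ℤ.+ + c ℤ.* + suc b ≡ + (a ℕ.* suc e ℕ.+ c ℕ.* suc b)
    numerator = trans (cong₂ ℤ._+_ (+-* a (suc e)) (+-* c (suc b)))
                      (sym (ℤₚ.pos-+ (a ℕ.* suc e) (c ℕ.* suc b)))

  0≡frac : 0ℚ ≡ frac 0 0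
  0≡frac = sym (frac-def 0 0)

  1≡frac : 1ℚ ≡ frac 1 0
  1≡frac = sym (frac-def 1 0)

  frac≥0 : ∀ k d → 0ℚ ≤ frac k d
  frac≥0 k d = subst (_≤ frac k d) (sym 0≡frac) (frac-≤ 0 0 k d z≤n)

  1≤frac : ∀ k d → d ℕ.< k → 1ℚ ≤ frac k d
  1≤frac k d d<k = subst (_≤ frac k d) (sym 1≡frac)
    (frac-≤ 1 0 k d (subst₂ ℕ._≤_ (sym (ℕₚ.*-identityˡ _)) (sym (ℕₚ.*-identityʳ k)) d<k))

  frac≤1 : ∀ k d → k ℕ.≤ suc d → frac k d ≤ 1ℚ
  frac≤1 k d k≤d+1 = subst (frac k d ≤_) (sym 1≡frac)
    (frac-≤ k d 1 0 (subst₂ ℕ._≤_ (sym (ℕₚ.*-identityʳ k)) (sym (ℕₚ.*-identityˡ _)) k≤d+1))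

  ratio-frac : ∀ k d → ratio k (suc d) ≡ frac k (suc d ℕ.+ d ℕ.* suc (suc d))
  ratio-frac k d = sym (frac-def k (suc d ℕ.+ d ℕ.* suc (suc d)))

  _·_ : ℕ → ℚ → ℚ
  zero  · ρ = 0ℚ
  suc m · ρ = ρ + m · ρ

  ·-0ℚ : ∀ m → m · 0ℚ ≡ 0ℚ
  ·-0ℚ zero = refl
  ·-0ℚ (suc m) = trans (ℚₚ.+-identityˡ (m · 0ℚ)) (·-0ℚ m)

  ·-frac : ∀ m a d → m · frac a d ≡ frac (m ℕ.* a) d
  ·-frac zero a d = trans 0≡frac (frac-cong 0 0 0 d refl)
  ·-frac (suc m) a d = begin
    frac a d + m · frac a d                 ≡⟨ cong (λ r → frac a d + r) (·-frac m a d) ⟩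
    frac a d + frac (m ℕ.* a) d             ≡⟨ frac-+ a d (m ℕ.* a) d ⟩
    frac (a ℕ.* suc d ℕ.+ m ℕ.* a ℕ.* suc d) (d ℕ.+ d ℕ.* suc d)
                                            ≡⟨ frac-cong _ _ _ _ (lemma a m d) ⟩
    frac (suc m ℕ.* a) d                    ∎
    where
    open ≡-Reasoning
    lemma : ∀ a m d → (a ℕ.* suc d ℕ.+ m ℕ.* a ℕ.* suc d) ℕ.* suc d
                      ≡ (a ℕ.+ m ℕ.* a) ℕ.* suc (d ℕ.+ d ℕ.* suc d)
    lemma = solve-∀

  -- 1/2 = 1/(1·2) is the largest possible Case 3 ratio
  ½ : ℚ
  ½ = frac 1 1

  ratio-1-1 : ratio 1 1 ≡ ½
  ratio-1-1 = sym (frac-def 1 1)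

  share : ℕ → ℕ → ℚ
  share k d = 1ℚ ⊓ frac k d

  share≥0 : ∀ k d → 0ℚ ≤ share k d
  share≥0 k d = ℚₚ.⊓-glb (subst₂ _≤_ (sym 0≡frac) (sym 1≡frac) (frac-≤ 0 0 1 0 z≤n)) (frac≥0 k d)

  share≤1 : ∀ k d → share k d ≤ 1ℚ
  share≤1 k d = ℚₚ.p⊓q≤p 1ℚ (frac k d)

  share-saturated : ∀ k d → d ℕ.< k → share k d ≡ 1ℚ
  share-saturated k d d<k = ℚₚ.p≤q⇒p⊓q≡p (1≤frac k d d<k)

  share-unsaturated : ∀ k d → k ℕ.≤ suc d → share k d ≡ frac k d
  share-unsaturated k d k≤d+1 = ℚₚ.p≥q⇒p⊓q≡q (frac≤1 k d k≤d+1)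

  share-mono : ∀ {a b c e} → frac a b ≤ frac c e ⊎ 1ℚ ≤ frac c e → share a b ≤ share c e
  share-mono {c = c} {e} (inj₁ le) = ℚₚ.⊓-monoʳ-≤ 1ℚ le
  share-mono {a = a} {b} {c} {e} (inj₂ 1≤) =
    ℚₚ.≤-trans (share≤1 a b) (ℚₚ.≤-reflexive (sym (ℚₚ.p≤q⇒p⊓q≡p 1≤)))

  share-pred : ∀ k d → share (k ∸ 1) d ≤ share k d
  share-pred k d = share-mono (inj₁ (frac-≤ (k ∸ 1) d k d (ℕₚ.*-monoˡ-≤ (suc d) (ℕₚ.m∸n≤m k 1))))

  share-pred-suc : ∀ k d → share (k ∸ 1) d ≤ share k (suc d)
  share-pred-suc zero d = share-mono (inj₁ (frac-≤ 0 d 0 (suc d) z≤n))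
  share-pred-suc (suc j) d with j ℕ.≤? suc d
  ... | yes j≤d+1 = share-mono (inj₁ (frac-≤ j d (suc j) (suc d) cross))
    where
    cross : j ℕ.* suc (suc d) ℕ.≤ suc j ℕ.* suc d
    cross = subst (ℕ._≤ suc j ℕ.* suc d) (sym (ℕₚ.*-suc j (suc d))) (ℕₚ.+-monoˡ-≤ (j ℕ.* suc d) j≤d+1)
  ... | no j≰d+1 = share-mono (inj₂ (1≤frac (suc j) (suc d) (s≤s (ℕₚ.<⇒≤ (ℕₚ.≰⇒> j≰d+1)))))

  frac-split : ∀ k d → frac k d ≡ frac k (suc d) + ratio k (suc d)
  frac-split k d = begin
    frac k d                                       ≡⟨ frac-cong _ _ _ _ (lemma k d) ⟩
    frac (k ℕ.* suc D ℕ.+ k ℕ.* suc (suc d)) (D ℕ.+ suc d ℕ.* suc D)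
                                                   ≡⟨ sym (frac-+ k (suc d) k D) ⟩
    frac k (suc d) + frac k D                      ≡⟨ cong (λ r → frac k (suc d) + r) (sym (ratio-frac k d)) ⟩
    frac k (suc d) + ratio k (suc d)               ∎
    where
    open ≡-Reasoning
    D : ℕ
    D = suc d ℕ.+ d ℕ.* suc (suc d)
    lemma : ∀ k d → k ℕ.* suc (suc d ℕ.+ d ℕ.* suc (suc d) ℕ.+ suc d ℕ.* suc (suc d ℕ.+ d ℕ.* suc (suc d)))
                  ≡ (k ℕ.* suc (suc d ℕ.+ d ℕ.* suc (suc d)) ℕ.+ k ℕ.* suc (suc d)) ℕ.* suc d
    lemma = solve-∀

  share-suc : ∀ k d → k ℕ.≤ suc d → share k d ≤ share k (suc d) + ratio k (suc d)
  share-suc k d k≤d+1 = ℚₚ.≤-trans (ℚₚ.p⊓q≤q 1ℚ (frac k d)) (ℚₚ.≤-reflexive (begin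
    frac k d                              ≡⟨ frac-split k d ⟩
    frac k (suc d) + ratio k (suc d)      ≡⟨ cong (_+ ratio k (suc d)) (sym unsaturated) ⟩
    share k (suc d) + ratio k (suc d)     ∎))
    where
    open ≡-Reasoning
    unsaturated : share k (suc d) ≡ frac k (suc d)
    unsaturated = share-unsaturated k (suc d) (ℕₚ.m≤n⇒m≤1+n k≤d+1)

  ratio≤½ : ∀ k d → k ℕ.≤ suc d → ratio k (suc d) ≤ ½
  ratio≤½ k d k≤d+1 = subst (_≤ ½) (sym (ratio-frac k d)) (frac-≤ k _ 1 1
    (ℕₚ.≤-trans (ℕₚ.*-monoˡ-≤ 2 k≤d+1)
      (subst (suc d ℕ.* 2 ℕ.≤_) (sym (ℕₚ.*-identityˡ _)) (ℕₚ.*-monoʳ-≤ (suc d) (s≤s (s≤s z≤n))))))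

  share-suc-½ : ∀ k d → share k d ≤ share k (suc d) + ½
  share-suc-½ k d with k ℕ.≤? suc d
  ... | yes k≤d+1 = ℚₚ.≤-trans (share-suc k d k≤d+1) (ℚₚ.+-monoʳ-≤ (share k (suc d)) (ratio≤½ k d k≤d+1))
  ... | no k≰d+1 = ℚₚ.≤-trans (share≤1 k d) (ℚₚ.≤-trans (ℚₚ.≤-reflexive (sym (ℚₚ.+-identityʳ 1ℚ)))
      (ℚₚ.+-mono-≤ (ℚₚ.≤-reflexive (sym (share-saturated k (suc d) (ℕₚ.≰⇒> k≰d+1))))
                   (subst (_≤ ½) (sym 0≡frac) (frac-≤ 0 0 1 1 z≤n))))

  -- the δ neighbours of a Case 3 vertex together gain at most its share: δ · k/(δ(δ+1)) = k/(δ+1)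
  ·-ratio≤share : ∀ k δ → 1 ℕ.≤ k → k ℕ.≤ δ → δ · ratio k δ ≤ share k δ
  ·-ratio≤share k zero 1≤k k≤0 = ⊥-elim (ℕₚ.<⇒≱ 1≤k k≤0)
  ·-ratio≤share k (suc d) _ k≤d+1 = ℚₚ.≤-reflexive (begin
    suc d · ratio k (suc d)  ≡⟨ cong (suc d ·_) (ratio-frac k d) ⟩
    suc d · frac k D         ≡⟨ ·-frac (suc d) k D ⟩
    frac (suc d ℕ.* k) D     ≡⟨ frac-cong _ _ _ _ (lemma k d) ⟩
    frac k (suc d)           ≡⟨ sym (share-unsaturated k (suc d) (ℕₚ.m≤n⇒m≤1+n k≤d+1)) ⟩
    share k (suc d)          ∎)
    where
    open ≡-Reasoning
    D : ℕ
    D = suc d ℕ.+ d ℕ.* suc (suc d)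
    lemma : ∀ k d → suc d ℕ.* k ℕ.* suc (suc d) ≡ k ℕ.* suc (suc d ℕ.+ d ℕ.* suc (suc d))
    lemma = solve-∀

  -- if 1 ≤ k ≤ δ then k/(δ(δ+1)) ≤ 1/(δ+1), which reaches 1/2 only for δ = 1
  ratio≥½⇒δ≡1 : ∀ k δ → 1 ℕ.≤ k → k ℕ.≤ δ → ½ ≤ ratio k δ → δ ≡ 1
  ratio≥½⇒δ≡1 k zero 1≤k k≤0 _ = ⊥-elim (ℕₚ.<⇒≱ 1≤k k≤0)
  ratio≥½⇒δ≡1 k (suc zero) _ _ _ = refl
  ratio≥½⇒δ≡1 k (suc (suc e)) _ k≤δ ½≤r =
    ⊥-elim (ℕₚ.<⇒≱ (s≤s (s≤s (s≤s z≤n))) (ℕₚ.*-cancelˡ-≤ (suc (suc e)) δ[δ+1]≤δ*2))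
    where
    D : ℕ
    D = suc (suc e) ℕ.+ suc e ℕ.* suc (suc (suc e))
    cross : 1 ℕ.* suc D ℕ.≤ k ℕ.* 2
    cross = frac-≤⁻ 1 1 k D (subst (½ ≤_) (ratio-frac k (suc e)) ½≤r)
    δ[δ+1]≤δ*2 : suc (suc e) ℕ.* suc (suc (suc e)) ℕ.≤ suc (suc e) ℕ.* 2
    δ[δ+1]≤δ*2 = ℕₚ.≤-trans (subst (ℕ._≤ k ℕ.* 2) (ℕₚ.*-identityˡ _) cross) (ℕₚ.*-monoˡ-≤ 2 k≤δ)

  ½≤share-1 : ∀ e → e ℕ.≤ 1 → ½ ≤ share 1 e
  ½≤share-1 e e≤1 = ℚₚ.⊓-glb (subst (½ ≤_) (sym 1≡frac) (frac-≤ 1 1 1 0 (s≤s z≤n)))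
                              (frac-≤ 1 1 1 e (ℕₚ.*-monoʳ-≤ 1 (s≤s e≤1)))

  ·1≡frac : ∀ m → m · 1ℚ ≡ frac m 0
  ·1≡frac m = begin
    m · 1ℚ          ≡⟨ cong (m ·_) 1≡frac ⟩
    m · frac 1 0    ≡⟨ ·-frac m 1 0 ⟩
    frac (m ℕ.* 1) 0 ≡⟨ cong (λ j → frac j 0) (ℕₚ.*-identityʳ m) ⟩
    frac m 0        ∎
    where open ≡-Reasoning

  ·1-≤-suc : ∀ m m′ → m ℕ.≤ suc m′ → m · 1ℚ ≤ m′ · 1ℚ + 1ℚ
  ·1-≤-suc m m′ m≤m′+1 = begin
    m · 1ℚ           ≡⟨ ·1≡frac m ⟩
    frac m 0         ≤⟨ frac-≤ m 0 (suc m′) 0 (ℕₚ.*-monoˡ-≤ 1 m≤m′+1) ⟩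
    frac (suc m′) 0  ≡⟨ sym (·1≡frac (suc m′)) ⟩
    1ℚ + m′ · 1ℚ     ≡⟨ ℚₚ.+-comm 1ℚ (m′ · 1ℚ) ⟩
    m′ · 1ℚ + 1ℚ     ∎
    where open ℚₚ.≤-Reasoning

module Sums where

  open import Data.Nat using (zero; suc)
  open import Data.Bool using (true; false; if_then_else_)
  open import Data.Fin using (zero; suc)
  open import Data.Fin.Subset using (Subset; _∈_; _∉_; ∣_∣)
  open import Data.Fin.Subset.Properties using (_∈?_)
  open import Data.Vec using ([]; _∷_; tabulate; foldr)
  open import Data.Rational using (ℚ; 0ℚ; _≤_; _+_; -_)
  import Data.Rational.Properties as ℚₚ
  open import Algebra.Bundles using (CommutativeMonoid)
  open import Algebra.Properties.CommutativeSemigroup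
    (CommutativeMonoid.commutativeSemigroup ℚₚ.+-0-commutativeMonoid)
    using () renaming (interchange to +-interchange)
  open import Function using (_∘_)
  open import Relation.Nullary using (does)
  open import Relation.Nullary.Decidable using (dec-true; dec-false)
  open import Relation.Binary.PropositionalEquality
  open Fractions using (_·_)

  -- Σ f = f 0 + f 1 + ⋯ + f (n-1), written as the fold used in the definition of `bound`
  Σ : ∀ {n} → (Fin n → ℚ) → ℚ
  Σ f = foldr _ _+_ 0ℚ (tabulate f)

  Σ-mono : ∀ {n} {f g : Fin n → ℚ} → (∀ i → f i ≤ g i) → Σ f ≤ Σ g
  Σ-mono {zero} f≤g = ℚₚ.≤-refl
  Σ-mono {suc n} f≤g = ℚₚ.+-mono-≤ (f≤g zero) (Σ-mono (f≤g ∘ suc))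

  Σ-+ : ∀ {n} (f g : Fin n → ℚ) → Σ (λ i → f i + g i) ≡ Σ f + Σ g
  Σ-+ {zero} f g = refl
  Σ-+ {suc n} f g = trans (cong ((f zero + g zero) +_) (Σ-+ (f ∘ suc) (g ∘ suc)))
                          (+-interchange (f zero) (g zero) (Σ (f ∘ suc)) (Σ (g ∘ suc)))

  restrict : ∀ {n} → Subset n → (Fin n → ℚ) → Fin n → ℚ
  restrict X f i = if does (i ∈? X) then f i else 0ℚ

  restrict-∈ : ∀ {n} {X : Subset n} {i} f → i ∈ X → restrict X f i ≡ f i
  restrict-∈ {X = X} {i} f i∈X = cong (if_then f i else 0ℚ) (dec-true (i ∈? X) i∈X)

  restrict-∉ : ∀ {n} {X : Subset n} {i} f → i ∉ X → restrict X f i ≡ 0ℚ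
  restrict-∉ {X = X} {i} f i∉X = cong (if_then f i else 0ℚ) (dec-false (i ∈? X) i∉X)

  on : ∀ {n} → Subset n → ℚ → Fin n → ℚ
  on X ρ = restrict X (λ _ → ρ)

  on-∈ : ∀ {n} {X : Subset n} {i} ρ → i ∈ X → on X ρ i ≡ ρ
  on-∈ ρ = restrict-∈ (λ _ → ρ)

  on-∉ : ∀ {n} {X : Subset n} {i} ρ → i ∉ X → on X ρ i ≡ 0ℚ
  on-∉ ρ = restrict-∉ (λ _ → ρ)

  Σ-on : ∀ {n} (X : Subset n) ρ → Σ (on X ρ) ≡ ∣ X ∣ · ρ
  Σ-on [] ρ = refl
  Σ-on (true ∷ X) ρ = cong (ρ +_) (Σ-on X ρ)
  Σ-on (false ∷ X) ρ = trans (ℚₚ.+-identityˡ _) (Σ-on X ρ)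

  Σ-nonneg : ∀ {n} {f : Fin n → ℚ} → (∀ i → 0ℚ ≤ f i) → 0ℚ ≤ Σ f
  Σ-nonneg {zero} f≥0 = ℚₚ.≤-refl
  Σ-nonneg {suc n} f≥0 = ℚₚ.+-mono-≤ (f≥0 zero) (Σ-nonneg (f≥0 ∘ suc))

  restrict-nonneg : ∀ {n} {X : Subset n} {f : Fin n → ℚ} → (∀ i → 0ℚ ≤ f i) → ∀ i → 0ℚ ≤ restrict X f i
  restrict-nonneg {X = X} f≥0 i with does (i ∈? X)
  ... | true = f≥0 i
  ... | false = ℚₚ.≤-refl

  on-0ℚ : ∀ {n} (X : Subset n) i → on X 0ℚ i ≡ 0ℚ
  on-0ℚ X i with does (i ∈? X)
  ... | true = refl
  ... | false = refl

  +-cancelʳ-≤ : ∀ x y c → x + c ≤ y + c → x ≤ y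
  +-cancelʳ-≤ x y c x+c≤y+c = subst₂ _≤_ (undo x) (undo y) (ℚₚ.+-monoˡ-≤ (- c) x+c≤y+c)
    where
    undo : ∀ z → (z + c) + - c ≡ z
    undo z = trans (ℚₚ.+-assoc z c (- c)) (trans (cong (z +_) (ℚₚ.+-inverseʳ c)) (ℚₚ.+-identityʳ z))

module Analysis {n : ℕ} (G : Graph n) (t : Fin n → ℕ) where

  open import Defs renaming (sym to Γ-sym)
  open import Data.Nat as ℕ using (zero; suc; _∸_; _≤_; _<_; _<?_; z≤n; s≤s)
  import Data.Nat.Properties as ℕₚ
  open import Data.Bool using (Bool; true; false; if_then_else_; _∨_; not; T)
  import Data.Bool.Properties as Boolₚ
  import Data.Fin.Properties as Finₚ
  open import Data.Fin.Subset using (Subset; _∈_; _∉_; _⊆_; ∣_∣; _∩_; _∪_; ∁; ⁅_⁆; ⊤; ⊥)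
  open import Data.Fin.Subset.Properties
  open import Data.Product using (_×_; _,_; proj₁; proj₂; ∃)
  open import Data.Sum using (inj₁; inj₂; [_,_]′)
  open import Data.Empty using (⊥-elim)
  open import Function using (id; _∘_)
  open import Relation.Nullary using (¬_; Dec; yes; no; does)
  open import Relation.Binary.PropositionalEquality
  open import Relation.Binary.Construct.Closure.ReflexiveTransitive using (Star; ε; _◅_)
  import Data.Integer as ℤ
  open import Data.Rational using (ℚ; 0ℚ; 1ℚ; _+_; _/_; _⊓_) renaming (_≤_ to _≤ℚ_)
  import Data.Rational.Properties as ℚₚ
  open import Relation.Nullary.Decidable using (dec-true; dec-false)
  open Subsets
  open Fractions
  open Sums

  A : Subset n
  A = setA G t

  ∉A⇒deg≤1 : ∀ {u} → u ∉ A → deg G u ≤ 1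
  ∉A⇒deg≤1 {u} u∉A with 2 ℕ.≤ᵇ deg G u in eq
  ... | true = ⊥-elim (u∉A (tabulate⁺ (cong (_∨ not (t u ℕ.≡ᵇ 1)) eq)))
  ... | false = ℕₚ.≤-pred (ℕₚ.≰⇒> (λ 2≤d → subst T eq (ℕₚ.≤⇒≤ᵇ 2≤d)))

  ∉A⇒t≡1 : ∀ {u} → u ∉ A → t u ≡ 1
  ∉A⇒t≡1 {u} u∉A with t u ℕ.≡ᵇ 1 in eq
  ... | true = ℕₚ.≡ᵇ⇒≡ (t u) 1 (subst T (sym eq) _)
  ... | false = ⊥-elim (u∉A (tabulate⁺ (trans (cong (λ b → (2 ℕ.≤ᵇ deg G u) ∨ not b) eq)
                                               (Boolₚ.∨-zeroʳ (2 ℕ.≤ᵇ deg G u)))))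

  module Connectivity (conn : Connected G) (3≤n : 3 ≤ n) where

    closed⇒all : ∀ {X : Subset n} {u} → (∀ {x y} → x ∈ X → y ∈ Γ G x → y ∈ X) → u ∈ X → ∀ w → w ∈ X
    closed⇒all {X} {u} closed u∈X w = walk (conn u w) u∈X
      where
      walk : ∀ {a b} → Star (Adj G) a b → a ∈ X → b ∈ X
      walk ε = id
      walk (a~c ◅ c~*b) a∈X = walk c~*b (closed a∈X a~c)

    small-closed : ∀ {X : Subset n} {u} → (∀ {x y} → x ∈ X → y ∈ Γ G x → y ∈ X) → u ∈ X → ¬ (∣ X ∣ ≤ 2)
    small-closed closed u∈X ∣X∣≤2 = ℕₚ.<⇒≱ 3≤n (ℕₚ.≤-trans (all⇒∣∣≥n (closed⇒all closed u∈X)) ∣X∣≤2)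

    -- every vertex has a neighbour: otherwise it alone would be closed under adjacency
    deg≥1 : ∀ u → 1 ≤ deg G u
    deg≥1 u with deg G u in eq
    ... | suc _ = s≤s z≤n
    ... | zero = ⊥-elim (small-closed closed (x∈⁅x⁆ u) (ℕₚ.≤-trans (ℕₚ.≤-reflexive (∣⁅x⁆∣≡1 u)) (s≤s z≤n)))
      where
      closed : ∀ {x y} → x ∈ ⁅ u ⁆ → y ∈ Γ G x → y ∈ ⁅ u ⁆
      closed x∈⁅u⁆ y∈Γx with x∈⁅y⁆⇒x≡y u x∈⁅u⁆
      ... | refl = ⊥-elim (ℕₚ.<⇒≱ (∈⇒∣∣≥1 y∈Γx) (ℕₚ.≤-reflexive eq))

    -- two vertices outside A are never adjacent: they would form a component of size two
    ∉A-independent : ∀ {u v} → u ∉ A → v ∉ A → v ∉ Γ G u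
    ∉A-independent {u} {v} u∉A v∉A v∈Γu = small-closed closed (x∈p∪q⁺ (inj₁ (x∈⁅x⁆ u)))
      (ℕₚ.≤-trans (∣∪∣≤ ⁅ u ⁆ ⁅ v ⁆) (ℕₚ.≤-reflexive (cong₂ ℕ._+_ (∣⁅x⁆∣≡1 u) (∣⁅x⁆∣≡1 v))))
      where
      pair : Subset n
      pair = ⁅ u ⁆ ∪ ⁅ v ⁆
      closed : ∀ {x y} → x ∈ pair → y ∈ Γ G x → y ∈ pair
      closed x∈pair y∈Γx with ∪⁻ x∈pair
      ... | inj₁ x∈⁅u⁆ rewrite x∈⁅y⁆⇒x≡y u x∈⁅u⁆ =
        x∈p∪q⁺ (inj₂ (subst (_∈ ⁅ v ⁆) (∣∣≤1⇒≡ (∉A⇒deg≤1 u∉A) v∈Γu y∈Γx) (x∈⁅x⁆ v)))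
      ... | inj₂ x∈⁅v⁆ rewrite x∈⁅y⁆⇒x≡y v x∈⁅v⁆ =
        x∈p∪q⁺ (inj₁ (subst (_∈ ⁅ u ⁆) (∣∣≤1⇒≡ (∉A⇒deg≤1 v∉A) (Γ-sym G v∈Γu) y∈Γx) (x∈⁅x⁆ u)))

  record Inv (st : TSSState n) : Set where
    field
      N≡ : ∀ {u} → u ∈ U st → N st u ≡ Γ G u ∩ U st
      δ≡ : ∀ {u} → u ∈ U st → δ st u ≡ ∣ N st u ∣
  open Inv public

  Inv-init : Inv (initState G t)
  Inv-init = record
    { N≡ = λ {u} _ → sym (∩-identityʳ (Γ G u))
    ; δ≡ = λ _ → refl
    }

  module _ {st : TSSState n} (I : Inv st) where

    N⊆Γ : ∀ {v u} → v ∈ U st → u ∈ N st v → u ∈ Γ G v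
    N⊆Γ v∈U u∈Nv = ∩ˡ (subst (_ ∈_) (N≡ I v∈U) u∈Nv)

    N⊆U : ∀ {v u} → v ∈ U st → u ∈ N st v → u ∈ U st
    N⊆U v∈U u∈Nv = ∩ʳ (subst (_ ∈_) (N≡ I v∈U) u∈Nv)

    N⁺ : ∀ {v u} → v ∈ U st → u ∈ Γ G v → u ∈ U st → u ∈ N st v
    N⁺ v∈U u∈Γv u∈U = subst (_ ∈_) (sym (N≡ I v∈U)) (∩⁺ u∈Γv u∈U)

    N-irrefl : ∀ {v} → v ∈ U st → v ∉ N st v
    N-irrefl v∈U v∈Nv = irrfl G (N⊆Γ v∈U v∈Nv)

    N-sym : ∀ {v u} → v ∈ U st → u ∈ N st v → v ∈ N st u
    N-sym v∈U u∈Nv = N⁺ (N⊆U v∈U u∈Nv) (Γ-sym G (N⊆Γ v∈U u∈Nv)) v∈U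

    Inv-removeV : ∀ {v} S′ k′ → v ∈ U st → Inv (removeV st v S′ k′)
    Inv-removeV {v} S′ k′ v∈U = record { N≡ = N≡′ ; δ≡ = δ≡′ }
      where
      st′ : TSSState n
      st′ = removeV st v S′ k′
      N≡′ : ∀ {u} → u ∈ U st′ → N st′ u ≡ Γ G u ∩ U st′
      N≡′ {u} u∈U′ with u ∈? N st v
      ... | yes u∈Nv = begin
        N st u ∩ ∁ ⁅ v ⁆          ≡⟨ cong (_∩ ∁ ⁅ v ⁆) (N≡ I (∩ˡ u∈U′)) ⟩
        (Γ G u ∩ U st) ∩ ∁ ⁅ v ⁆  ≡⟨ ∩-assoc (Γ G u) (U st) (∁ ⁅ v ⁆) ⟩
        Γ G u ∩ U st′             ∎
        where open ≡-Reasoning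
      ... | no u∉Nv = begin
        N st u                    ≡⟨ N≡ I (∩ˡ u∈U′) ⟩
        Γ G u ∩ U st              ≡⟨ sym (remove-∉ (Γ G u ∩ U st) v∉Γu) ⟩
        (Γ G u ∩ U st) ∩ ∁ ⁅ v ⁆  ≡⟨ ∩-assoc (Γ G u) (U st) (∁ ⁅ v ⁆) ⟩
        Γ G u ∩ U st′             ∎
        where
        open ≡-Reasoning
        v∉Γu : v ∉ Γ G u ∩ U st
        v∉Γu v∈Γu = u∉Nv (N⁺ v∈U (Γ-sym G (∩ˡ v∈Γu)) (∩ˡ u∈U′))
      δ≡′ : ∀ {u} → u ∈ U st′ → δ st′ u ≡ ∣ N st′ u ∣
      δ≡′ {u} u∈U′ with u ∈? N st v
      ... | yes u∈Nv = trans (cong (_∸ 1) (δ≡ I (∩ˡ u∈U′))) (cong (_∸ 1) (∣remove∣ (N st u) (N-sym v∈U u∈Nv)))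
      ... | no _ = δ≡ I (∩ˡ u∈U′)

  -- Potential.  An undecided vertex u ∈ A weighs min(1, k(u)/(|N(u) ∩ A|+1)); an undecided
  -- leaf outside A weighs 1 exactly when it can no longer be activated by its neighbour.
  bit : Bool → ℚ
  bit b = if b then 1ℚ else 0ℚ

  τ : TSSState n → Fin n → ℚ
  τ st u = if does (u ∈? A) then share (k st u) ∣ N st u ∩ A ∣ else bit (does (δ st u <? k st u))

  Ψ : TSSState n → ℚ
  Ψ st = Σ (restrict (U st) (τ st))

  Φ : TSSState n → ℚ
  Φ st = ∣ S st ∣ · 1ℚ + Ψ st

  τ-∈A : ∀ st {u} → u ∈ A → τ st u ≡ share (k st u) ∣ N st u ∩ A ∣
  τ-∈A st {u} u∈A = cong (if_then share (k st u) ∣ N st u ∩ A ∣ else bit (does (δ st u <? k st u)))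
                         (dec-true (u ∈? A) u∈A)

  τ-∉A : ∀ st {u} → u ∉ A → τ st u ≡ bit (does (δ st u <? k st u))
  τ-∉A st {u} u∉A = cong (if_then share (k st u) ∣ N st u ∩ A ∣ else bit (does (δ st u <? k st u)))
                         (dec-false (u ∈? A) u∉A)

  bit≥0 : ∀ b → 0ℚ ≤ℚ bit b
  bit≥0 true = ℚₚ.≤-trans (share≥0 1 0) (share≤1 1 0)
  bit≥0 false = ℚₚ.≤-refl

  bit≤1 : ∀ b → bit b ≤ℚ 1ℚ
  bit≤1 true = ℚₚ.≤-refl
  bit≤1 false = bit≥0 true

  bit-mono : ∀ {P Q : Set} (P? : Dec P) (Q? : Dec Q) → (P → Q) → bit (does P?) ≤ℚ bit (does Q?)
  bit-mono (yes p) (yes q) P⇒Q = ℚₚ.≤-refl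
  bit-mono (yes p) (no ¬q) P⇒Q = ⊥-elim (¬q (P⇒Q p))
  bit-mono (no ¬p) Q? P⇒Q = bit≥0 (does Q?)

  τ≥0 : ∀ st u → 0ℚ ≤ℚ τ st u
  τ≥0 st u with does (u ∈? A)
  ... | true = share≥0 (k st u) ∣ N st u ∩ A ∣
  ... | false = bit≥0 _

  Ψ≥0 : ∀ st → 0ℚ ≤ℚ Ψ st
  Ψ≥0 st = Σ-nonneg (restrict-nonneg (τ≥0 st))

  k-dec : TSSState n → Fin n → Fin n → ℕ
  k-dec st v = updOn (N st v) (λ x → x ∸ 1) (k st)

  module Removal {st : TSSState n} (I : Inv st) {v : Fin n} (v∈U : v ∈ U st) where

    -- Removing v moves its weight τ(v) to its neighbours: if every other undecided vertex
    -- gains at most ρ, and only when it is a neighbour of v, then Ψ′ + τ(v) ≤ Ψ + ∣N(v)∣ · ρ.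
    Ψ-transfer : ∀ S′ k′ ρ →
      (∀ {u} → u ∈ U st → u ≢ v → τ (removeV st v S′ k′) u ≤ℚ τ st u + on (N st v) ρ u) →
      Ψ (removeV st v S′ k′) + τ st v ≤ℚ Ψ st + ∣ N st v ∣ · ρ
    Ψ-transfer S′ k′ ρ gain = begin
      Ψ st′ + τv                                  ≡⟨ cong (Ψ st′ +_) (sym Σ-on-v) ⟩
      Ψ st′ + Σ (on ⁅ v ⁆ τv)                     ≡⟨ sym (Σ-+ ψ′ (on ⁅ v ⁆ τv)) ⟩
      Σ (λ u → ψ′ u + on ⁅ v ⁆ τv u)              ≤⟨ Σ-mono (λ u → pointwise u (u Finₚ.≟ v) (u ∈? U st)) ⟩
      Σ (λ u → ψ u + on (N st v) ρ u)             ≡⟨ Σ-+ ψ (on (N st v) ρ) ⟩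
      Ψ st + Σ (on (N st v) ρ)                    ≡⟨ cong (Ψ st +_) (Σ-on (N st v) ρ) ⟩
      Ψ st + ∣ N st v ∣ · ρ                       ∎
      where
      open ℚₚ.≤-Reasoning
      st′ : TSSState n
      st′ = removeV st v S′ k′
      τv : ℚ
      τv = τ st v
      ψ ψ′ : Fin n → ℚ
      ψ = restrict (U st) (τ st)
      ψ′ = restrict (U st′) (τ st′)

      Σ-on-v : Σ (on ⁅ v ⁆ τv) ≡ τv
      Σ-on-v = trans (Σ-on ⁅ v ⁆ τv) (trans (cong (_· τv) (∣⁅x⁆∣≡1 v)) (ℚₚ.+-identityʳ τv))

      pointwise : ∀ u → Dec (u ≡ v) → Dec (u ∈ U st) → ψ′ u + on ⁅ v ⁆ τv u ≤ℚ ψ u + on (N st v) ρ u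
      pointwise u (yes refl) _ = ℚₚ.≤-reflexive (begin-equality
        ψ′ v + on ⁅ v ⁆ τv v
          ≡⟨ cong₂ _+_ (restrict-∉ {X = U st′} (τ st′) (λ v∈U′ → remove⁻ v∈U′ refl)) (on-∈ τv (x∈⁅x⁆ v)) ⟩
        0ℚ + τv                 ≡⟨ trans (ℚₚ.+-identityˡ τv) (sym (ℚₚ.+-identityʳ τv)) ⟩
        τv + 0ℚ                 ≡⟨ sym (cong₂ _+_ (restrict-∈ (τ st) v∈U) (on-∉ ρ (N-irrefl I v∈U))) ⟩
        ψ v + on (N st v) ρ v   ∎)
      pointwise u (no u≢v) (yes u∈U) = begin
        ψ′ u + on ⁅ v ⁆ τv u
          ≡⟨ cong₂ _+_ (restrict-∈ {X = U st′} (τ st′) (remove⁺ u∈U u≢v)) (on-∉ τv (u≢v ∘ x∈⁅y⁆⇒x≡y v)) ⟩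
        τ st′ u + 0ℚ              ≡⟨ ℚₚ.+-identityʳ (τ st′ u) ⟩
        τ st′ u                   ≤⟨ gain u∈U u≢v ⟩
        τ st u + on (N st v) ρ u  ≡⟨ cong (_+ on (N st v) ρ u) (sym (restrict-∈ (τ st) u∈U)) ⟩
        ψ u + on (N st v) ρ u     ∎
      pointwise u (no u≢v) (no u∉U) = ℚₚ.≤-reflexive (cong₂ _+_
        (trans (restrict-∉ {X = U st′} (τ st′) (u∉U ∘ ∩ˡ)) (sym (restrict-∉ (τ st) u∉U)))
        (trans (on-∉ τv (u≢v ∘ x∈⁅y⁆⇒x≡y v)) (sym (on-∉ ρ (u∉U ∘ N⊆U I v∈U)))))

    -- Accounting for one step that removes v from U: if moreover S grows by at most b and
    -- τ(v) pays for b and for the ∣N(v)∣ gains, then Φ does not increase.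
    Φ-removeV : ∀ S′ k′ (b ρ : ℚ) →
      ∣ S′ ∣ · 1ℚ ≤ℚ ∣ S st ∣ · 1ℚ + b →
      (∀ {u} → u ∈ U st → u ≢ v → τ (removeV st v S′ k′) u ≤ℚ τ st u + on (N st v) ρ u) →
      b + ∣ N st v ∣ · ρ ≤ℚ τ st v →
      Φ (removeV st v S′ k′) ≤ℚ Φ st
    Φ-removeV S′ k′ b ρ S-growth gain pay = begin
      ∣ S′ ∣ · 1ℚ + Ψ st′               ≤⟨ ℚₚ.+-monoˡ-≤ (Ψ st′) S-growth ⟩
      (∣ S st ∣ · 1ℚ + b) + Ψ st′       ≡⟨ ℚₚ.+-assoc (∣ S st ∣ · 1ℚ) b (Ψ st′) ⟩
      ∣ S st ∣ · 1ℚ + (b + Ψ st′)       ≤⟨ ℚₚ.+-monoʳ-≤ (∣ S st ∣ · 1ℚ) Ψ-drop ⟩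
      ∣ S st ∣ · 1ℚ + Ψ st              ∎
      where
      open ℚₚ.≤-Reasoning
      st′ : TSSState n
      st′ = removeV st v S′ k′
      c : ℚ
      c = ∣ N st v ∣ · ρ

      Ψ-drop : b + Ψ st′ ≤ℚ Ψ st
      Ψ-drop = +-cancelʳ-≤ (b + Ψ st′) (Ψ st) c (begin
        (b + Ψ st′) + c        ≡⟨ cong (_+ c) (ℚₚ.+-comm b (Ψ st′)) ⟩
        (Ψ st′ + b) + c        ≡⟨ ℚₚ.+-assoc (Ψ st′) b c ⟩
        Ψ st′ + (b + c)        ≤⟨ ℚₚ.+-monoʳ-≤ (Ψ st′) pay ⟩
        Ψ st′ + τ st v         ≤⟨ Ψ-transfer S′ k′ ρ gain ⟩
        Ψ st + c               ∎)

    -- A neighbour of v loses one unit of k together with the edge to v; its weight cannot grow.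
    τ-decrement : ∀ S′ {u} → u ∈ U st → τ (removeV st v S′ (k-dec st v)) u ≤ℚ τ st u
    τ-decrement S′ {u} u∈U with u ∈? N st v
    ... | no _ = ℚₚ.≤-refl
    ... | yes u∈Nv with u ∈? A
    ...   | no _ = bit-mono (δ st u ∸ 1 <? k st u ∸ 1) (δ st u <? k st u) (pred-<-pred δu≥1)
      where
      δu≥1 : 1 ≤ δ st u
      δu≥1 = subst (1 ≤_) (sym (δ≡ I u∈U)) (∈⇒∣∣≥1 (N-sym I v∈U u∈Nv))
      pred-<-pred : ∀ {a b} → 1 ≤ a → a ∸ 1 < b ∸ 1 → a < b
      pred-<-pred {suc a} {suc b} _ a<b = s≤s a<b
    ...   | yes _ with v ∈? A
    ...     | yes v∈A = subst (λ d → share (k st u ∸ 1) ∣ (N st u ∩ ∁ ⁅ v ⁆) ∩ A ∣ ≤ℚ share (k st u) d)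
                          (sym (∣remove∩∣ (N st u) A (N-sym I v∈U u∈Nv) v∈A))
                          (share-pred-suc (k st u) ∣ (N st u ∩ ∁ ⁅ v ⁆) ∩ A ∣)
    ...     | no v∉A = subst (λ d → share (k st u ∸ 1) d ≤ℚ share (k st u) ∣ N st u ∩ A ∣)
                         (sym (∣remove∩∣-∉ (N st u) A v∉A))
                         (share-pred (k st u) ∣ N st u ∩ A ∣)

    gain-decrement : ∀ S′ {u} → u ∈ U st → u ≢ v → τ (removeV st v S′ (k-dec st v)) u ≤ℚ τ st u + on (N st v) 0ℚ u
    gain-decrement S′ {u} u∈U _ = subst (τ (removeV st v S′ (k-dec st v)) u ≤ℚ_)
      (sym (trans (cong (τ st u +_) (on-0ℚ (N st v) u)) (ℚₚ.+-identityʳ (τ st u))))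
      (τ-decrement S′ u∈U)

    pay-nothing : ∀ b → b ≤ℚ τ st v → b + ∣ N st v ∣ · 0ℚ ≤ℚ τ st v
    pay-nothing b b≤τv = subst (_≤ℚ τ st v)
      (sym (trans (cong (b +_) (·-0ℚ ∣ N st v ∣)) (ℚₚ.+-identityʳ b))) b≤τv

    Φ-case1 : Φ (removeV st v (S st) (k-dec st v)) ≤ℚ Φ st
    Φ-case1 = Φ-removeV (S st) (k-dec st v) 0ℚ 0ℚ
      (ℚₚ.≤-reflexive (sym (ℚₚ.+-identityʳ _)))
      (gain-decrement (S st))
      (pay-nothing 0ℚ (τ≥0 st v))

    τ-saturated : δ st v < k st v → τ st v ≡ 1ℚ
    τ-saturated δ<k with v ∈? A
    ... | yes _ = share-saturated (k st v) ∣ N st v ∩ A ∣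
                    (ℕₚ.≤-<-trans (∣p∩q∣≤∣p∣ (N st v) A) (subst (_< k st v) (δ≡ I v∈U) δ<k))
    ... | no _ = cong bit (dec-true (δ st v <? k st v) δ<k)

    Φ-case2 : δ st v < k st v → Φ (removeV st v (S st ∪ ⁅ v ⁆) (k-dec st v)) ≤ℚ Φ st
    Φ-case2 δ<k = Φ-removeV (S st ∪ ⁅ v ⁆) (k-dec st v) 1ℚ 0ℚ
      (·1-≤-suc ∣ S st ∪ ⁅ v ⁆ ∣ ∣ S st ∣ ∣S∪v∣≤)
      (gain-decrement (S st ∪ ⁅ v ⁆))
      (pay-nothing 1ℚ (ℚₚ.≤-reflexive (sym (τ-saturated δ<k))))
      where
      ∣S∪v∣≤ : ∣ S st ∪ ⁅ v ⁆ ∣ ≤ suc ∣ S st ∣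
      ∣S∪v∣≤ = ℕₚ.≤-trans (∣∪∣≤ (S st) ⁅ v ⁆)
                 (ℕₚ.≤-reflexive (trans (cong (∣ S st ∣ ℕ.+_) (∣⁅x⁆∣≡1 v)) (ℕₚ.+-comm ∣ S st ∣ 1)))

    module Case3 (conn : Connected G) (3≤n : 3 ≤ n)
        (k≢0 : ∀ u → u ∈ U st → k st u ≢ 0)
        (¬δ<k : ∀ u → u ∈ U st → ¬ (δ st u < k st u))
        (maximal : ∀ u → u ∈ U st → ratio (k st u) (δ st u) ≤ℚ ratio (k st v) (δ st v)) where

      open Connectivity conn 3≤n

      st₃ : TSSState n
      st₃ = removeV st v (S st) (k st)

      1≤k : ∀ {w} → w ∈ U st → 1 ≤ k st w
      1≤k {w} w∈U = ℕₚ.n≢0⇒n>0 (k≢0 w w∈U)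

      k≤δ : ∀ {w} → w ∈ U st → k st w ≤ δ st w
      k≤δ {w} w∈U = ℕₚ.≮⇒≥ (¬δ<k w w∈U)

      Φ-case3-by : ∀ ρ → (∀ {u} → u ∈ N st v → τ st₃ u ≤ℚ τ st u + ρ) → ∣ N st v ∣ · ρ ≤ℚ τ st v →
                   Φ st₃ ≤ℚ Φ st
      Φ-case3-by ρ gain pay = Φ-removeV (S st) (k st) 0ℚ ρ
        (ℚₚ.≤-reflexive (sym (ℚₚ.+-identityʳ _)))
        (λ {u} _ _ → gain′ u (u ∈? N st v))
        (ℚₚ.≤-trans (ℚₚ.≤-reflexive (ℚₚ.+-identityˡ _)) pay)
        where
        gain′ : ∀ u → Dec (u ∈ N st v) → τ st₃ u ≤ℚ τ st u + on (N st v) ρ u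
        gain′ u (yes u∈Nv) = subst (λ r → τ st₃ u ≤ℚ τ st u + r) (sym (on-∈ ρ u∈Nv)) (gain u∈Nv)
        gain′ u (no u∉Nv) = ℚₚ.≤-reflexive (sym (trans (cong (τ st u +_) (on-∉ ρ u∉Nv))
                                                     (trans (ℚₚ.+-identityʳ (τ st u)) (τ-unchanged u∉Nv))))
          where
          τ-unchanged : u ∉ N st v → τ st u ≡ τ st₃ u
          τ-unchanged u∉Nv with u ∈? N st v
          ... | yes u∈Nv = ⊥-elim (u∉Nv u∈Nv)
          ... | no _ = refl

      -- Sub-case δ(v) = k(v) = 1: the single neighbour u of v gains at most τ(v).
      Φ-case3-leaf : δ st v ≡ 1 → k st v ≡ 1 → Φ st₃ ≤ℚ Φ st
      Φ-case3-leaf δv≡1 kv≡1 = Φ-case3-by (τ st v) gain (ℚₚ.≤-reflexive pay)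
        where
        ∣Nv∣≡1 : ∣ N st v ∣ ≡ 1
        ∣Nv∣≡1 = trans (sym (δ≡ I v∈U)) δv≡1

        pay : ∣ N st v ∣ · τ st v ≡ τ st v
        pay = trans (cong (_· τ st v) ∣Nv∣≡1) (ℚₚ.+-identityʳ (τ st v))

        gain : ∀ {u} → u ∈ N st v → τ st₃ u ≤ℚ τ st u + τ st v
        gain {u} u∈Nv with u ∈? N st v
        ... | no u∉Nv = ⊥-elim (u∉Nv u∈Nv)
        ... | yes _ with u ∈? A | v ∈? A
        ...   | yes _ | yes v∈A =
          -- u loses an A-neighbour (at most +1/2), and v, with one neighbour and k(v) = 1, weighs ≥ 1/2
          subst (λ d → share (k st u) ∣ (N st u ∩ ∁ ⁅ v ⁆) ∩ A ∣
                         ≤ℚ share (k st u) d + share (k st v) ∣ N st v ∩ A ∣)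
            (sym (∣remove∩∣ (N st u) A (N-sym I v∈U u∈Nv) v∈A))
            (ℚₚ.≤-trans (share-suc-½ (k st u) ∣ (N st u ∩ ∁ ⁅ v ⁆) ∩ A ∣)
              (ℚₚ.+-monoʳ-≤ (share (k st u) (suc ∣ (N st u ∩ ∁ ⁅ v ⁆) ∩ A ∣))
                (subst (λ j → ½ ≤ℚ share j ∣ N st v ∩ A ∣) (sym kv≡1)
                (½≤share-1 ∣ N st v ∩ A ∣ (ℕₚ.≤-trans (∣p∩q∣≤∣p∣ (N st v) A) (ℕₚ.≤-reflexive ∣Nv∣≡1))))))
        ...   | yes _ | no v∉A =
          -- u loses a neighbour outside A, which does not change its weight
          subst (λ d → share (k st u) d ≤ℚ share (k st u) ∣ N st u ∩ A ∣ + bit (does (δ st v <? k st v)))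
            (sym (∣remove∩∣-∉ (N st u) A v∉A))
            (ℚₚ.≤-trans (ℚₚ.≤-reflexive (sym (ℚₚ.+-identityʳ τu)))
                        (ℚₚ.+-monoʳ-≤ τu (bit≥0 (does (δ st v <? k st v)))))
          where
          τu : ℚ
          τu = share (k st u) ∣ N st u ∩ A ∣
        ...   | no u∉A | yes _ =
          -- v's only neighbour u lies outside A, so v weighs min(1, 1/1) = 1 ≥ τ₃(u)
          ℚₚ.≤-trans (bit≤1 (does (δ st u ∸ 1 <? k st u)))
            (ℚₚ.≤-trans (ℚₚ.≤-reflexive (sym τv≡1))
              (ℚₚ.≤-trans (ℚₚ.≤-reflexive (sym (ℚₚ.+-identityˡ τv)))
                          (ℚₚ.+-monoˡ-≤ τv (bit≥0 (does (δ st u <? k st u))))))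
          where
          ∣Nv∩A∣≡0 : ∣ N st v ∩ A ∣ ≡ 0
          ∣Nv∩A∣≡0 = ℕₚ.n≤0⇒n≡0 (ℕₚ.≤-pred (ℕₚ.≤-trans
            (p⊂q⇒∣p∣<∣q∣ (∩ˡ , u , u∈Nv , u∉A ∘ ∩ʳ)) (ℕₚ.≤-reflexive ∣Nv∣≡1)))
          τv : ℚ
          τv = share (k st v) ∣ N st v ∩ A ∣
          τv≡1 : τv ≡ 1ℚ
          τv≡1 = subst₂ (λ j d → share j d ≡ 1ℚ) (sym kv≡1) (sym ∣Nv∩A∣≡0) (share-saturated 1 0 (s≤s z≤n))
        ...   | no u∉A | no v∉A = ⊥-elim (∉A-independent v∉A u∉A (N⊆Γ I v∈U u∈Nv))

      -- Otherwise every undecided vertex lies in A, and each neighbour of v gains at most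
      -- k(v)/(δ(v)(δ(v)+1)), the largest ratio; v's weight k(v)/(δ(v)+1) covers δ(v) such gains.
      module NotLeaf (not-leaf : ¬ (δ st v ≡ 1 × k st v ≡ 1)) where

        -- an undecided vertex w ∉ A has k(w) = δ(w) = 1, so its ratio 1/2 would force δ(v) = k(v) = 1
        U⊆A : ∀ {w} → w ∈ U st → w ∈ A
        U⊆A {w} w∈U with w ∈? A
        ... | yes w∈A = w∈A
        ... | no w∉A = ⊥-elim (not-leaf (δv≡1 , kv≡1))
          where
          δw≤1 : δ st w ≤ 1
          δw≤1 = subst (_≤ 1) (sym (δ≡ I w∈U))
                   (ℕₚ.≤-trans (p⊆q⇒∣p∣≤∣q∣ (N⊆Γ I w∈U)) (∉A⇒deg≤1 w∉A))
          kw≡1 : k st w ≡ 1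
          kw≡1 = ℕₚ.≤-antisym (ℕₚ.≤-trans (k≤δ w∈U) δw≤1) (1≤k w∈U)
          δw≡1 : δ st w ≡ 1
          δw≡1 = ℕₚ.≤-antisym δw≤1 (ℕₚ.≤-trans (1≤k w∈U) (k≤δ w∈U))
          ½≤ratio-v : ½ ≤ℚ ratio (k st v) (δ st v)
          ½≤ratio-v = subst₂ _≤ℚ_ (trans (cong₂ ratio kw≡1 δw≡1) ratio-1-1) refl (maximal w w∈U)
          δv≡1 : δ st v ≡ 1
          δv≡1 = ratio≥½⇒δ≡1 (k st v) (δ st v) (1≤k v∈U) (k≤δ v∈U) ½≤ratio-v
          kv≡1 : k st v ≡ 1
          kv≡1 = ℕₚ.≤-antisym (subst (k st v ≤_) δv≡1 (k≤δ v∈U)) (1≤k v∈U)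

        ∣N∩A∣≡δ : ∀ {w} → w ∈ U st → ∣ N st w ∩ A ∣ ≡ δ st w
        ∣N∩A∣≡δ w∈U = trans (cong ∣_∣ (⊆-antisym ∩ˡ (λ x∈N → ∩⁺ x∈N (U⊆A (N⊆U I w∈U x∈N)))))
                            (sym (δ≡ I w∈U))

        ρ : ℚ
        ρ = ratio (k st v) (δ st v)

        gain : ∀ {u} → u ∈ N st v → τ st₃ u ≤ℚ τ st u + ρ
        gain {u} u∈Nv with u ∈? N st v
        ... | no u∉Nv = ⊥-elim (u∉Nv u∈Nv)
        ... | yes _ with u ∈? A
        ...   | no u∉A = ⊥-elim (u∉A (U⊆A u∈U))
          where
          u∈U : u ∈ U st
          u∈U = N⊆U I v∈U u∈Nv
        ...   | yes _ = subst (λ d → share (k st u) e ≤ℚ share (k st u) d + ρ) e+1≡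
                          (ℚₚ.≤-trans (share-suc (k st u) e (subst (k st u ≤_) δu≡e+1 (k≤δ u∈U)))
                            (ℚₚ.+-monoʳ-≤ (share (k st u) (suc e))
                              (subst (λ d → ratio (k st u) d ≤ℚ ρ) δu≡e+1 (maximal u u∈U))))
          where
          u∈U : u ∈ U st
          u∈U = N⊆U I v∈U u∈Nv
          e : ℕ
          e = ∣ (N st u ∩ ∁ ⁅ v ⁆) ∩ A ∣
          e+1≡ : suc e ≡ ∣ N st u ∩ A ∣
          e+1≡ = sym (∣remove∩∣ (N st u) A (N-sym I v∈U u∈Nv) (U⊆A v∈U))
          δu≡e+1 : δ st u ≡ suc e
          δu≡e+1 = trans (sym (∣N∩A∣≡δ u∈U)) (sym e+1≡)

        pay : ∣ N st v ∣ · ρ ≤ℚ τ st v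
        pay = subst₂ (λ m r → m · ρ ≤ℚ r) (δ≡ I v∈U)
                (sym (trans (τ-∈A st (U⊆A v∈U)) (cong (share (k st v)) (∣N∩A∣≡δ v∈U))))
                (·-ratio≤share (k st v) (δ st v) (1≤k v∈U) (k≤δ v∈U))

        Φ-case3-spread : Φ st₃ ≤ℚ Φ st
        Φ-case3-spread = Φ-case3-by ρ gain pay

      Φ-case3 : Φ st₃ ≤ℚ Φ st
      Φ-case3 with δ st v ℕ.≟ 1 | k st v ℕ.≟ 1
      ... | yes δv≡1 | yes kv≡1 = Φ-case3-leaf δv≡1 kv≡1
      ... | no δv≢1  | _        = NotLeaf.Φ-case3-spread (δv≢1 ∘ proj₁)
      ... | yes _    | no kv≢1  = NotLeaf.Φ-case3-spread (kv≢1 ∘ proj₂)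

  Inv-step : ∀ {st st′ : TSSState n} → TSSStep st st′ → Inv st → Inv st′
  Inv-step (case1 st v v∈U _) I = Inv-removeV I _ _ v∈U
  Inv-step (case2 st v _ v∈U _) I = Inv-removeV I _ _ v∈U
  Inv-step (case3 st v _ _ v∈U _) I = Inv-removeV I _ _ v∈U

  S-step : ∀ {st st′ : TSSState n} → TSSStep st st′ → S st ⊆ S st′
  S-step (case1 _ _ _ _) = id
  S-step (case2 st v _ _ _) = p⊆p∪q ⁅ v ⁆
  S-step (case3 _ _ _ _ _ _) = id

  S-run : ∀ {st st′ : TSSState n} → Star TSSStep st st′ → S st ⊆ S st′
  S-run ε = id
  S-run (step ◅ steps) = S-run steps ∘ S-step step

  module _ (conn : Connected G) (3≤n : 3 ≤ n) where

    Φ-step : ∀ {st st′} → TSSStep st st′ → Inv st → Φ st′ ≤ℚ Φ st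
    Φ-step (case1 st v v∈U _) I = Removal.Φ-case1 I v∈U
    Φ-step (case2 st v _ v∈U δ<k) I = Removal.Φ-case2 I v∈U δ<k
    Φ-step (case3 st v k≢0 ¬δ<k v∈U maximal) I = Removal.Case3.Φ-case3 I v∈U conn 3≤n k≢0 ¬δ<k maximal

    Φ-run : ∀ {st st′} → Star TSSStep st st′ → Inv st → Φ st′ ≤ℚ Φ st
    Φ-run ε I = ℚₚ.≤-refl
    Φ-run (step ◅ steps) I = ℚₚ.≤-trans (Φ-run steps (Inv-step step I)) (Φ-step step I)

    -- Initially S = ∅ and Ψ is exactly the bound: a leaf outside A has threshold 1 ≤ its degree.
    Φ-init : Φ (initState G t) ≤ℚ bound G t
    Φ-init = begin
      ∣ ⊥ {n} ∣ · 1ℚ + Ψ st₀   ≡⟨ cong (λ m → m · 1ℚ + Ψ st₀) (∣⊥∣≡0 n) ⟩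
      0ℚ + Ψ st₀              ≡⟨ ℚₚ.+-identityˡ (Ψ st₀) ⟩
      Ψ st₀                   ≤⟨ Σ-mono (λ u → τ₀≤term u (u ∈? A)) ⟩
      bound G t               ∎
      where
      open ℚₚ.≤-Reasoning
      open Connectivity conn 3≤n
      st₀ : TSSState n
      st₀ = initState G t
      τ₀≤term : ∀ u (u∈?A : Dec (u ∈ A)) →
        restrict ⊤ (τ st₀) u ≤ℚ (if does u∈?A then 1ℚ ⊓ ((ℤ.+ t u) / suc (deg2 G t u)) else 0ℚ)
      τ₀≤term u (yes u∈A) = ℚₚ.≤-reflexive (begin-equality
        restrict ⊤ (τ st₀) u                  ≡⟨ restrict-∈ (τ st₀) (∈⊤ {x = u}) ⟩
        τ st₀ u                               ≡⟨ τ-∈A st₀ u∈A ⟩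
        1ℚ ⊓ frac (t u) (deg2 G t u)          ≡⟨ cong (1ℚ ⊓_) (frac-def (t u) (deg2 G t u)) ⟩
        1ℚ ⊓ ((ℤ.+ t u) / suc (deg2 G t u))   ∎)
      τ₀≤term u (no u∉A) = ℚₚ.≤-reflexive (begin-equality
        restrict ⊤ (τ st₀) u                  ≡⟨ restrict-∈ (τ st₀) (∈⊤ {x = u}) ⟩
        τ st₀ u                               ≡⟨ τ-∉A st₀ u∉A ⟩
        bit (does (deg G u <? t u))           ≡⟨ cong bit (dec-false (deg G u <? t u) deg≮t) ⟩
        0ℚ                                    ∎)
        where
        deg≮t : ¬ (deg G u < t u)
        deg≮t = ℕₚ.≤⇒≯ (subst (_≤ deg G u) (sym (∉A⇒t≡1 u∉A)) (deg≥1 u))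

  ∣S∣≤Φ : ∀ st → (ℤ.+ ∣ S st ∣) / 1 ≤ℚ Φ st
  ∣S∣≤Φ st = begin
    (ℤ.+ ∣ S st ∣) / 1       ≡⟨ sym (trans (·1≡frac ∣ S st ∣) (frac-def ∣ S st ∣ 0)) ⟩
    ∣ S st ∣ · 1ℚ            ≡⟨ sym (ℚₚ.+-identityʳ _) ⟩
    ∣ S st ∣ · 1ℚ + 0ℚ       ≤⟨ ℚₚ.+-monoʳ-≤ (∣ S st ∣ · 1ℚ) (Ψ≥0 st) ⟩
    Φ st                     ∎
    where open ℚₚ.≤-Reasoning

  module Activation (S-final : Subset n) where

    Act : ℕ → Subset n
    Act = Active G t S-final

    Act-suc : ∀ ℓ → Act ℓ ⊆ Act (suc ℓ)
    Act-suc ℓ = p⊆p∪q _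

    Act-mono : ∀ {ℓ ℓ′} → ℓ ≤ ℓ′ → Act ℓ ⊆ Act ℓ′
    Act-mono ℓ≤ℓ′ = mono′ (ℕₚ.≤⇒≤′ ℓ≤ℓ′)
      where
      mono′ : ∀ {ℓ ℓ′} → ℓ ℕ.≤′ ℓ′ → Act ℓ ⊆ Act ℓ′
      mono′ ℕ.≤′-refl = id
      mono′ {ℓ} {suc ℓ′} (ℕ.≤′-step ℓ≤′ℓ′) = Act-suc ℓ′ ∘ mono′ ℓ≤′ℓ′

    S⊆Act : ∀ ℓ → S-final ⊆ Act ℓ
    S⊆Act ℓ = Act-mono {0} {ℓ} z≤n

    Act-step : ∀ ℓ {u} → t u ≤ ∣ Γ G u ∩ Act ℓ ∣ → u ∈ Act (suc ℓ)
    Act-step ℓ {u} t≤ = q⊆p∪q (Act ℓ) _ (tabulate⁺ (dec-true (t u ℕ.≤? ∣ Γ G u ∩ Act ℓ ∣) t≤))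

    ⊆Act-removeV : ∀ {st v} ℓ ℓ′ → v ∈ Act ℓ → U st ∩ ∁ ⁅ v ⁆ ⊆ Act ℓ′ → U st ⊆ Act (ℓ ℕ.⊔ ℓ′)
    ⊆Act-removeV {v = v} ℓ ℓ′ v∈Act U′⊆Act {u} u∈U with u Finₚ.≟ v
    ... | yes refl = Act-mono (ℕₚ.m≤m⊔n ℓ ℓ′) v∈Act
    ... | no u≢v = Act-mono (ℕₚ.m≤n⊔m ℓ ℓ′) (U′⊆Act (remove⁺ u∈U u≢v))

    Done : TSSState n → ℕ → Fin n → Subset n
    Done st ℓ u = Γ G u ∩ (∁ (U st) ∩ Act ℓ)

    -- the invariant of the run: what TSS still requires of u (k(u)) together with the
    -- neighbours already done covers the threshold t(u)
    Covered : TSSState n → ℕ → Set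
    Covered st ℓ = ∀ {u} → u ∈ U st → t u ≤ k st u ℕ.+ ∣ Done st ℓ u ∣

    Done⊆Γ∩Act : ∀ st {ℓ ℓ′} u → ℓ ≤ ℓ′ → Done st ℓ u ⊆ Γ G u ∩ Act ℓ′
    Done⊆Γ∩Act st u ℓ≤ℓ′ x∈Done = ∩⁺ (∩ˡ x∈Done) (Act-mono ℓ≤ℓ′ (∩ʳ (∩ʳ {p = Γ G u} x∈Done)))

    Done-mono : ∀ {st v S′ k′ ℓ ℓ′} → ℓ ≤ ℓ′ → ∀ u → Done st ℓ u ⊆ Done (removeV st v S′ k′) ℓ′ u
    Done-mono {st} {ℓ = ℓ} ℓ≤ℓ′ u {x} x∈Done = ∩⁺ (∩ˡ x∈Done)
      (∩⁺ (x∉p⇒x∈∁p (x∈∁p⇒x∉p (∩ˡ x∈U∁∩Act) ∘ ∩ˡ)) (Act-mono ℓ≤ℓ′ (∩ʳ x∈U∁∩Act)))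
      where
      x∈U∁∩Act : x ∈ ∁ (U st) ∩ Act ℓ
      x∈U∁∩Act = ∩ʳ {p = Γ G u} x∈Done

    module _ {st : TSSState n} (I : Inv st) {v : Fin n} (v∈U : v ∈ U st) where

      -- Cases 1 and 2: once v is active, a neighbour's lost unit of k is made up by v ∈ Done
      Covered-dec : ∀ S′ {ℓ ℓ′} → ℓ ≤ ℓ′ → v ∈ Act ℓ′ → Covered st ℓ →
                    Covered (removeV st v S′ (k-dec st v)) ℓ′
      Covered-dec S′ {ℓ} {ℓ′} ℓ≤ℓ′ v∈Act cov {u} u∈U′ with u ∈? N st v
      ... | no _ = ℕₚ.≤-trans (cov (∩ˡ u∈U′))
        (ℕₚ.+-monoʳ-≤ (k st u) (p⊆q⇒∣p∣≤∣q∣ (Done-mono {st} {v} {S′} {k-dec st v} ℓ≤ℓ′ u)))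
      ... | yes u∈Nv = ℕₚ.≤-trans (cov (∩ˡ u∈U′)) (begin
        k st u ℕ.+ ∣ Done st ℓ u ∣            ≤⟨ ℕₚ.+-monoˡ-≤ _ (ℕₚ.m≤n+m∸n (k st u) 1) ⟩
        suc (k st u ∸ 1) ℕ.+ ∣ Done st ℓ u ∣  ≡⟨ sym (ℕₚ.+-suc (k st u ∸ 1) _) ⟩
        (k st u ∸ 1) ℕ.+ suc ∣ Done st ℓ u ∣  ≤⟨ ℕₚ.+-monoʳ-≤ (k st u ∸ 1) Done<Done′ ⟩
        (k st u ∸ 1) ℕ.+ ∣ Done st′ ℓ′ u ∣    ∎)
        where
        open ℕₚ.≤-Reasoning
        st′ : TSSState n
        st′ = removeV st v S′ (k-dec st v)
        v∈Done′ : v ∈ Done st′ ℓ′ u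
        v∈Done′ = ∩⁺ (N⊆Γ I (∩ˡ u∈U′) (N-sym I v∈U u∈Nv))
                     (∩⁺ (x∉p⇒x∈∁p (λ v∈U′ → remove⁻ v∈U′ refl)) v∈Act)
        Done<Done′ : ∣ Done st ℓ u ∣ < ∣ Done st′ ℓ′ u ∣
        Done<Done′ = p⊂q⇒∣p∣<∣q∣ (Done-mono {st} {v} {S′} {k-dec st v} ℓ≤ℓ′ u , v , v∈Done′ ,
                                  λ v∈Done → x∈∁p⇒x∉p (∩ˡ (∩ʳ {p = Γ G u} v∈Done)) v∈U)

      -- Case 3 leaves k unchanged
      Covered-keep : ∀ {ℓ} → Covered st ℓ → Covered (removeV st v (S st) (k st)) ℓ
      Covered-keep {ℓ} cov {u} u∈U′ = ℕₚ.≤-trans (cov (∩ˡ u∈U′))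
        (ℕₚ.+-monoʳ-≤ (k st u) (p⊆q⇒∣p∣≤∣q∣ (Done-mono {st} {v} {S st} {k st} {ℓ} ℕₚ.≤-refl u)))

    module _ {fin : TSSState n} (U-fin : U fin ≡ ⊥) (S-fin : S fin ≡ S-final) where

      activates : ∀ {st} ℓ → Star TSSStep st fin → Inv st → Covered st ℓ → ∃ λ Λ → U st ⊆ Act Λ
      activates ℓ ε I cov = 0 , λ {u} u∈U → ⊥-elim (∉⊥ (subst (u ∈_) U-fin u∈U))
      activates {st} ℓ (step@(case1 _ v v∈U k≡0) ◅ steps) I cov =
        suc ℓ ℕ.⊔ Λ , ⊆Act-removeV {st} (suc ℓ) Λ v∈Act U′⊆Act
        where
        -- k(v) = 0: the done neighbours alone reach t(v)
        v∈Act : v ∈ Act (suc ℓ)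
        v∈Act = Act-step ℓ (ℕₚ.≤-trans (cov v∈U)
                  (subst (λ j → j ℕ.+ ∣ Done st ℓ v ∣ ≤ ∣ Γ G v ∩ Act ℓ ∣) (sym k≡0)
                    (p⊆q⇒∣p∣≤∣q∣ (Done⊆Γ∩Act st {ℓ} v ℕₚ.≤-refl))))
        rest : ∃ λ Λ → U st ∩ ∁ ⁅ v ⁆ ⊆ Act Λ
        rest = activates (suc ℓ) steps (Inv-step step I) (Covered-dec I v∈U (S st) (ℕₚ.n≤1+n ℓ) v∈Act cov)
        Λ : ℕ
        Λ = proj₁ rest
        U′⊆Act : U st ∩ ∁ ⁅ v ⁆ ⊆ Act Λ
        U′⊆Act = proj₂ rest
      activates {st} ℓ (step@(case2 _ v _ v∈U _) ◅ steps) I cov =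
        ℓ ℕ.⊔ Λ , ⊆Act-removeV {st} ℓ Λ v∈Act U′⊆Act
        where
        -- v was put into S
        v∈Act : v ∈ Act ℓ
        v∈Act = S⊆Act ℓ (subst (v ∈_) S-fin (S-run steps (q⊆p∪q (S st) ⁅ v ⁆ (x∈⁅x⁆ v))))
        rest : ∃ λ Λ → U st ∩ ∁ ⁅ v ⁆ ⊆ Act Λ
        rest = activates ℓ steps (Inv-step step I) (Covered-dec I v∈U (S st ∪ ⁅ v ⁆) {ℓ} {ℓ} ℕₚ.≤-refl v∈Act cov)
        Λ : ℕ
        Λ = proj₁ rest
        U′⊆Act : U st ∩ ∁ ⁅ v ⁆ ⊆ Act Λ
        U′⊆Act = proj₂ rest
      activates {st} ℓ (step@(case3 _ v _ ¬δ<k v∈U _) ◅ steps) I cov =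
        suc L ℕ.⊔ Λ , ⊆Act-removeV {st} (suc L) Λ v∈Act U′⊆Act
        where
        rest : ∃ λ Λ → U st ∩ ∁ ⁅ v ⁆ ⊆ Act Λ
        rest = activates ℓ steps (Inv-step step I) (Covered-keep I v∈U {ℓ} cov)
        Λ : ℕ
        Λ = proj₁ rest
        U′⊆Act : U st ∩ ∁ ⁅ v ⁆ ⊆ Act Λ
        U′⊆Act = proj₂ rest
        L : ℕ
        L = ℓ ℕ.⊔ Λ
        -- v's remaining neighbours are activated later, so t(v) ≤ k(v) + |Done| ≤ |N(v)| + |Done|
        N⊆Act : N st v ⊆ Γ G v ∩ Act L
        N⊆Act x∈Nv = ∩⁺ (N⊆Γ I v∈U x∈Nv) (Act-mono (ℕₚ.m≤n⊔m ℓ Λ)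
                       (U′⊆Act (remove⁺ (N⊆U I v∈U x∈Nv) (λ { refl → N-irrefl I v∈U x∈Nv }))))
        Done⊆Act : Done st ℓ v ⊆ Γ G v ∩ Act L
        Done⊆Act = Done⊆Γ∩Act st v (ℕₚ.m≤m⊔n ℓ Λ)
        disjoint : ∀ {x} → x ∈ N st v → x ∉ Done st ℓ v
        disjoint x∈Nv x∈Done = x∈∁p⇒x∉p (∩ˡ (∩ʳ {p = Γ G v} x∈Done)) (N⊆U I v∈U x∈Nv)
        v∈Act : v ∈ Act (suc L)
        v∈Act = Act-step L (begin
          t v                                  ≤⟨ cov v∈U ⟩
          k st v ℕ.+ ∣ Done st ℓ v ∣            ≤⟨ ℕₚ.+-monoˡ-≤ _ (ℕₚ.≮⇒≥ (¬δ<k v v∈U)) ⟩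
          δ st v ℕ.+ ∣ Done st ℓ v ∣            ≡⟨ cong (ℕ._+ ∣ Done st ℓ v ∣) (δ≡ I v∈U) ⟩
          ∣ N st v ∣ ℕ.+ ∣ Done st ℓ v ∣        ≡⟨ sym (∣∪∣-disjoint (N st v) (Done st ℓ v) disjoint) ⟩
          ∣ N st v ∪ Done st ℓ v ∣              ≤⟨ p⊆q⇒∣p∣≤∣q∣ (λ x∈∪ → [ N⊆Act , Done⊆Act ]′ (∪⁻ x∈∪)) ⟩
          ∣ Γ G v ∩ Act L ∣                     ∎)
          where open ℕₚ.≤-Reasoning

open import Defs
open import Data.Nat using (ℕ; _≤_)
open import Data.Fin using (Fin)
open import Data.Fin.Subset using (Subset; ∣_∣)
open import Data.Integer using (+_)
open import Data.Rational using (_/_)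
open import Data.Product using (_×_)

import Data.Nat.Properties as ℕₚ
import Data.Rational.Properties as ℚₚ
open import Data.Fin.Subset using (_⊆_)
open import Data.Fin.Subset.Properties using (⊆-antisym; ⊆⊤; ∈⊤)
open import Data.Product using (_,_; proj₁; proj₂; ∃)
open import Relation.Binary.PropositionalEquality using (subst)

theorem2 : ∀ {n : ℕ} (G : Graph n) (t : Fin n → ℕ) →
    Connected G → 3 ≤ n →
    ∀ (S : Subset n) → TSSOutput G t S →
    IsTargetSet G t S × Data.Rational._≤_ ((+ ∣ S ∣) / 1) (bound G t)
theorem2 G t conn 3≤n S₀ (fin , run , U-fin , S-fin) = target-set , size-bound
  where
  open Analysis G t
  open Activation S₀
  -- initially every vertex is undecided and nothing is done, so Covered holds at level 0
  all-activated : ∃ λ Λ → U (initState G t) ⊆ Act Λ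
  all-activated = activates U-fin S-fin 0 run Inv-init (λ {u} _ → ℕₚ.m≤m+n (t u) _)
  target-set : IsTargetSet G t S₀
  target-set = proj₁ all-activated , ⊆-antisym ⊆⊤ (λ _ → proj₂ all-activated ∈⊤)
  size-bound : Data.Rational._≤_ ((+ ∣ S₀ ∣) / 1) (bound G t)
  size-bound = subst (λ X → Data.Rational._≤_ ((+ ∣ X ∣) / 1) (bound G t)) S-fin
    (ℚₚ.≤-trans (∣S∣≤Φ fin) (ℚₚ.≤-trans (Φ-run conn 3≤n run Inv-init) (Φ-init conn 3≤n)))
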